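{- Let $m\ge 3$ be an integer. The complete bipartite graph $K_{2,m}$ is a planar $(\{2,m\};4)$-cage, and every planar $(\{2,m\};4)$-cage is isomorphic to $K_{2,m}$.
   Context: All graphs are finite and simple. The girth of a graph is the length of a shortest cycle. For integers $2\le r<m$ and $g\ge 3$, an $(\{r,m\};g)$-graph is a graph of girth $g$ in which every vertex has degree $r$ or $m$, with at least one vertex of each of these degrees. A planar $(\{r,m\};g)$-cage is a planar $(\{r,m\};g)$-graph of minimum order among all planar $(\{r,m\};g)$-graphs. -}

module Defs where

open import Data.Nat using (ℕ; zero; suc; _+_; _*_; _≤_; _<_)
open import Data.Bool using (Bool; true; false; _∧_; _∨_; not; if_then_else_)
open import Data.Fin using (Fin; toℕ; _≟_)
import Data.Fin as Fin
open import Data.Nat using (_≡ᵇ_; _<ᵇ_)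
open import Data.Product using (Σ; _×_; _,_; ∃)
open import Data.Sum using (_⊎_)
open import Relation.Nullary using (¬_; does)
open import Relation.Binary.PropositionalEquality using (_≡_)
open import Function.Definitions using (Injective)
open import Function.Bundles using (_↔_; Inverse)

record Graph (n : ℕ) : Set where
  field
    adj   : Fin n → Fin n → Bool
    sym   : ∀ u v → adj u v ≡ adj v u
    irrefl : ∀ u → adj u u ≡ false
open Graph public

count : ∀ {n} → (Fin n → Bool) → ℕ
count {zero}  p = 0
count {suc n} p = (if p Fin.zero then 1 else 0) + count (λ i → p (Fin.suc i))

sumF : ∀ {n} → (Fin n → ℕ) → ℕ
sumF {zero}  f = 0
sumF {suc n} f = f Fin.zero + sumF (λ i → f (Fin.suc i))

anyF : ∀ {n} → (Fin n → Bool) → Bool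
anyF {zero}  p = false
anyF {suc n} p = p Fin.zero ∨ anyF (λ i → p (Fin.suc i))

eqF : ∀ {n} → Fin n → Fin n → Bool
eqF a b = does (a ≟ b)

degree : ∀ {n} → Graph n → Fin n → ℕ
degree G u = count (adj G u)

edges : ∀ {n} → Graph n → ℕ
edges G = sumF (λ u → count (λ v → adj G u v ∧ (toℕ u <ᵇ toℕ v)))

HasCycle : ∀ {n} → Graph n → ℕ → Set
HasCycle {n} G k =
  (3 ≤ k) ×
  Σ (Fin k → Fin n) λ f →
    Injective _≡_ _≡_ f ×
    (∀ (i j : Fin k) →
       (suc (toℕ i) ≡ toℕ j ⊎ (suc (toℕ i) ≡ k × toℕ j ≡ 0)) →
       adj G (f i) (f j) ≡ true)

HasGirth : ∀ {n} → Graph n → ℕ → Set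
HasGirth G g = HasCycle G g × (∀ k → k < g → ¬ HasCycle G k)

iter : ∀ {A : Set} → (A → A) → ℕ → A → A
iter f zero    a = a
iter f (suc k) a = f (iter f k a)

reach : ∀ {n} → Graph n → ℕ → Fin n → Fin n → Bool
reach G zero    u v = eqF u v
reach G (suc k) u v = reach G k u v ∨ anyF (λ w → reach G k u w ∧ adj G w v)

-- number of connected components: vertices not reachable from a smaller vertex
components : ∀ {n} → Graph n → ℕ
components {n} G =
  count (λ v → not (anyF (λ w → (toℕ w <ᵇ toℕ v) ∧ reach G n w v)))

isolated : ∀ {n} → Graph n → ℕ
isolated G = count (λ v → degree G v ≡ᵇ 0)

-- A rotation system: for every vertex u, ρ u is a cyclic permutation of
-- the neighbourhood of u (it maps neighbours to neighbours and the
-- ρ u-orbit of any neighbour contains every neighbour).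
record Rotation {n : ℕ} (G : Graph n) : Set where
  field
    ρ      : Fin n → Fin n → Fin n
    closed : ∀ u v → adj G u v ≡ true → adj G u (ρ u v) ≡ true
    cyclic : ∀ u v w → adj G u v ≡ true → adj G u w ≡ true →
             ∃ λ k → iter (ρ u) k v ≡ w
open Rotation public

Dart : ℕ → Set
Dart n = Fin n × Fin n

facePerm : ∀ {n} {G : Graph n} → Rotation G → Dart n → Dart n
facePerm R (u , v) = (v , ρ R v u)

rank : ∀ {n} → Dart n → ℕ
rank {n} (u , v) = toℕ u * n + toℕ v

-- a dart is the representative of its face if it has minimal rank in its
-- facePerm-orbit (orbits have length ≤ n * n)
isFaceRep : ∀ {n} {G : Graph n} → Rotation G → Dart n → Bool
isFaceRep {n} R d = not (anyHelper (n * n))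
  where
    anyHelper : ℕ → Bool
    anyHelper zero    = false
    anyHelper (suc k) = (rank (iter (facePerm R) (suc k) d) <ᵇ rank d) ∨ anyHelper k

-- number of faces of the embedding (each isolated vertex bounds one face,
-- by the usual convention)
faces : ∀ {n} {G : Graph n} → Rotation G → ℕ
faces {n} {G} R =
  sumF (λ u → count (λ v → adj G u v ∧ isFaceRep R (u , v))) + isolated G

-- G is planar: it has a rotation system satisfying Euler's formula
-- V - E + F = 2 on every component, i.e. V + F = E + 2·(#components)
-- (each component has V-E+F ≤ 2, so this is genus 0 on every component).
Planar : ∀ {n} → Graph n → Set
Planar {n} G = Σ (Rotation G) λ R → n + faces R ≡ edges G + 2 * components G

IsRMGGraph : ∀ {n} → ℕ → ℕ → ℕ → Graph n → Set
IsRMGGraph r m g G =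
  HasGirth G g ×
  (∀ u → degree G u ≡ r ⊎ degree G u ≡ m) ×
  (∃ λ u → degree G u ≡ r) ×
  (∃ λ u → degree G u ≡ m)

IsPlanarCage : ∀ {n} → ℕ → ℕ → ℕ → Graph n → Set
IsPlanarCage {n} r m g G =
  Planar G × IsRMGGraph r m g G ×
  (∀ n' (H : Graph n') → Planar H → IsRMGGraph r m g H → n ≤ n')

Isomorphic : ∀ {n n'} → Graph n → Graph n' → Set
Isomorphic {n} {n'} G H =
  Σ (Fin n ↔ Fin n') λ f →
    ∀ u v → adj H (Inverse.to f u) (Inverse.to f v) ≡ adj G u v

-- The complete bipartite graph K_{a,b}: vertices 0..a-1 on one side

xorB : Bool → Bool → Bool
xorB true  b = not b
xorB false b = b

xor-sym : ∀ a b → xorB a b ≡ xorB b a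
xor-sym true  true  = _≡_.refl
xor-sym true  false = _≡_.refl
xor-sym false true  = _≡_.refl
xor-sym false false = _≡_.refl

xor-self : ∀ a → xorB a a ≡ false
xor-self true  = _≡_.refl
xor-self false = _≡_.refl

K : (a b : ℕ) → Graph (a + b)
K a b = record
  { adj    = λ u v → xorB (toℕ u <ᵇ a) (toℕ v <ᵇ a)
  ; sym    = λ u v → xor-sym (toℕ u <ᵇ a) (toℕ v <ᵇ a)
  ; irrefl = λ u → xor-self (toℕ u <ᵇ a)
  }

{-# OPTIONS --safe #-}

-- A ({2,m};4)-graph is triangle-free of minimum degree 2.  If v has degree m,
-- then v itself and any other neighbour of a neighbour of v are two
-- non-neighbours of v, so the order is at least m + 2.  At order m + 2, v has
-- exactly one further non-neighbour w; every other vertex x is adjacent to v,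
-- the second neighbour of x must be w (anything else closes a triangle with v),
-- and no two such x are adjacent (again a triangle with v): the graph is K₂,ₘ
-- with sides {v, w}.  Conversely K₂,ₘ has girth 4, attains the bound, and is
-- planar: with the leaves ordered cyclically around one hub and in reverse
-- around the other, the faces are the m four-cycles hub₀ ℓⱼ hub₁ ℓⱼ₋₁, and
-- (m + 2) - 2m + m = 2.

module Submission where

open import Defs hiding (sym)
open import Data.Bool using (Bool; true; false; _∧_; _∨_; not)
open import Data.Bool.Properties using (∧-conicalˡ; ∧-conicalʳ; ∨-zeroʳ; ¬-not; not-injective)
open import Data.Fin using (Fin; zero; suc; toℕ; _≟_)
open import Data.Fin.Properties using (toℕ-fromℕ<; toℕ-injective; toℕ<n)
open import Data.Fin.Permutation using (Permutation′; transpose; _∘ₚ_; _⟨$⟩ʳ_)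
import Data.Fin.Permutation.Components as PC
open import Data.List using (List; []; _∷_; length)
open import Data.List.Relation.Unary.All as All using (All; []; _∷_)
open import Data.List.Relation.Unary.AllPairs using ([]; _∷_)
open import Data.List.Relation.Unary.Unique.Propositional using (Unique)
open import Data.Nat
  using (ℕ; zero; suc; _+_; _*_; _∸_; _≤_; _<_; _≤′_; _<ᵇ_; _≡ᵇ_; _<?_; z≤n; s≤s; ≤′-refl; ≤′-step)
open import Data.Nat.DivMod
  using (_%_; _mod_; [m+kn]%n≡m%n; [m+n]%n≡m%n; m<n⇒m%n≡m; m%n%n≡m%n; %-distribˡ-+; n%n≡0)
open import Data.Nat.Properties hiding (_≟_)
open import Data.Product using (∃; _×_; _,_; proj₁; proj₂)
open import Data.Sum using (_⊎_; inj₁; inj₂)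
open import Data.Empty using (⊥; ⊥-elim)
open import Function using (_∘_)
open import Function.Definitions using (Injective)
open import Function.Bundles using (Injection)
open import Function.Properties.Inverse using (↔⇒↣)
open import Relation.Binary.PropositionalEquality
open import Relation.Nullary using (¬_; yes; no)
open import Relation.Nullary.Decidable using (dec-true; dec-false)

private variable
  k n : ℕ

eqF-refl : (a : Fin n) → eqF a a ≡ true
eqF-refl a = dec-true (a ≟ a) refl

eqF-≢ : {a b : Fin n} → a ≢ b → eqF a b ≡ false
eqF-≢ {a = a} {b} = dec-false (a ≟ b)

not-eqF⇒≢ : {a b : Fin n} → not (eqF a b) ≡ true → a ≢ b
not-eqF⇒≢ {a = a} h refl with () ← trans (sym h) (cong not (eqF-refl a))

count-ext : {p q : Fin n → Bool} → (∀ x → p x ≡ q x) → count p ≡ count q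
count-ext {zero}  p≗q = refl
count-ext {suc n} {p} {q} p≗q rewrite p≗q zero =
  cong (_ +_) (count-ext {p = λ x → p (suc x)} {q = λ x → q (suc x)} (λ x → p≗q (suc x)))

count-true : count {n} (λ _ → true) ≡ n
count-true {zero}  = refl
count-true {suc n} = cong suc (count-true {n})

count-false : count {n} (λ _ → false) ≡ 0
count-false {zero}  = refl
count-false {suc n} = count-false {n}

count-eqF : (a : Fin n) → count (λ x → eqF x a) ≡ 1
count-eqF {suc n} zero    = cong suc (count-false {n})
count-eqF         (suc a) = count-eqF a

count-split : (p q : Fin n → Bool) →
  count p ≡ count (λ x → p x ∧ q x) + count (λ x → p x ∧ not (q x))
count-split {zero}  p q = refl
count-split {suc n} p q with p zero | q zero
... | true  | true  = cong suc (count-split (λ x → p (suc x)) (λ x → q (suc x)))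
... | true  | false = trans (cong suc (count-split (λ x → p (suc x)) (λ x → q (suc x))))
                            (sym (+-suc _ _))
... | false | _     = count-split (λ x → p (suc x)) (λ x → q (suc x))

count-mono : {p q : Fin n → Bool} → (∀ x → p x ≡ true → q x ≡ true) → count p ≤ count q
count-mono {zero}          p⇒q = z≤n
count-mono {suc n} {p} {q} p⇒q with p zero in p0 | q zero in q0
... | true  | true  = s≤s (count-mono {p = λ x → p (suc x)} (λ x → p⇒q (suc x)))
... | true  | false with () ← trans (sym (p⇒q zero p0)) q0
... | false | true  = m≤n⇒m≤1+n (count-mono {p = λ x → p (suc x)} (λ x → p⇒q (suc x)))
... | false | false = count-mono {p = λ x → p (suc x)} (λ x → p⇒q (suc x))

count-pos : (p : Fin n → Bool) {x : Fin n} → p x ≡ true → 1 ≤ count p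
count-pos p {zero}  px rewrite px = s≤s z≤n
count-pos p {suc x} px with p zero
... | true  = s≤s z≤n
... | false = count-pos (λ i → p (suc i)) px

count-witness : (p : Fin n → Bool) → 1 ≤ count p → ∃ λ x → p x ≡ true
count-witness {suc n} p h with p zero in p0
... | true  = zero , p0
... | false with count-witness (λ i → p (suc i)) h
...   | x , px = suc x , px

count-witness-≢ : (p : Fin n → Bool) → 2 ≤ count p → (a : Fin n) →
  ∃ λ x → p x ≡ true × x ≢ a
count-witness-≢ p h a with count-witness (λ x → p x ∧ not (eqF x a)) others
  where
  atA≤1 : count (λ x → p x ∧ eqF x a) ≤ 1
  atA≤1 = subst (count (λ x → p x ∧ eqF x a) ≤_) (count-eqF a)
                (count-mono (λ x → ∧-conicalʳ (p x) _))
  others : 1 ≤ count (λ x → p x ∧ not (eqF x a))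
  others = +-cancelˡ-≤ 1 _ _ (≤-trans h (≤-trans (≤-reflexive (count-split p (λ x → eqF x a)))
                                                 (+-monoˡ-≤ _ atA≤1)))
... | x , px∧x≢a = x , ∧-conicalˡ _ _ px∧x≢a , not-eqF⇒≢ (∧-conicalʳ _ _ px∧x≢a)

length≤count : (p : Fin n → Bool) {xs : List (Fin n)} →
  Unique xs → All (λ x → p x ≡ true) xs → length xs ≤ count p
length≤count p []             []         = z≤n
length≤count p {x ∷ xs} (x∉xs ∷ u) (px ∷ ps) = begin
  1 + length xs  ≤⟨ +-mono-≤ atX (length≤count _ u (All.zipWith offX (x∉xs , ps))) ⟩
  count (λ y → p y ∧ eqF y x) + count (λ y → p y ∧ not (eqF y x)) ≡⟨ count-split p _ ⟨
  count p        ∎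
  where
  open ≤-Reasoning
  atX : 1 ≤ count (λ y → p y ∧ eqF y x)
  atX = count-pos (λ y → p y ∧ eqF y x) (cong₂ _∧_ px (eqF-refl x))
  offX : ∀ {y} → x ≢ y × p y ≡ true → (p y ∧ not (eqF y x)) ≡ true
  offX (x≢y , py) = cong₂ _∧_ py (cong not (eqF-≢ (x≢y ∘ sym)))

rotate : ℕ → Fin (suc k) → Fin (suc k)
rotate {k} s i = (toℕ i + s) mod suc k

toℕ-rotate : (s : ℕ) (i : Fin (suc k)) → toℕ (rotate s i) ≡ (toℕ i + s) % suc k
toℕ-rotate s i = toℕ-fromℕ< _

rotate-full : (t : ℕ) (i : Fin (suc k)) → rotate (t * suc k) i ≡ i
rotate-full {k} t i = toℕ-injective (begin
  toℕ (rotate (t * suc k) i)    ≡⟨ toℕ-rotate _ i ⟩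
  (toℕ i + t * suc k) % suc k   ≡⟨ [m+kn]%n≡m%n (toℕ i) t (suc k) ⟩
  toℕ i % suc k                 ≡⟨ m<n⇒m%n≡m (toℕ<n i) ⟩
  toℕ i                         ∎)
  where open ≡-Reasoning

rotate-rotate : (s t : ℕ) (i : Fin (suc k)) → rotate t (rotate s i) ≡ rotate (s + t) i
rotate-rotate {k} s t i = toℕ-injective (begin
  toℕ (rotate t (rotate s i))                 ≡⟨ toℕ-rotate t (rotate s i) ⟩
  (toℕ (rotate s i) + t) % suc k              ≡⟨ cong (λ a → (a + t) % suc k) (toℕ-rotate s i) ⟩
  ((toℕ i + s) % suc k + t) % suc k           ≡⟨ %-distribˡ-+ ((toℕ i + s) % suc k) t (suc k) ⟩
  ((toℕ i + s) % suc k % suc k + t % suc k) % suc k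
    ≡⟨ cong (λ a → (a + t % suc k) % suc k) (m%n%n≡m%n (toℕ i + s) (suc k)) ⟩
  ((toℕ i + s) % suc k + t % suc k) % suc k   ≡⟨ %-distribˡ-+ (toℕ i + s) t (suc k) ⟨
  (toℕ i + s + t) % suc k                     ≡⟨ cong (_% suc k) (+-assoc (toℕ i) s t) ⟩
  (toℕ i + (s + t)) % suc k                   ≡⟨ toℕ-rotate (s + t) i ⟨
  toℕ (rotate (s + t) i)                      ∎)
  where open ≡-Reasoning

iter-rotate : (s t : ℕ) (i : Fin (suc k)) → iter (rotate s) t i ≡ rotate (t * s) i
iter-rotate s zero    i = sym (rotate-full 0 i)
iter-rotate s (suc t) i = begin
  rotate s (iter (rotate s) t i)  ≡⟨ cong (rotate s) (iter-rotate s t i) ⟩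
  rotate s (rotate (t * s) i)     ≡⟨ rotate-rotate (t * s) s i ⟩
  rotate (t * s + s) i            ≡⟨ cong (λ u → rotate u i) (+-comm (t * s) s) ⟩
  rotate (s + t * s) i            ∎
  where open ≡-Reasoning

rotate-reaches : (i j : Fin (suc k)) → rotate (suc k ∸ toℕ i + toℕ j) i ≡ j
rotate-reaches {k} i j = toℕ-injective (begin
  toℕ (rotate (suc k ∸ toℕ i + toℕ j) i)   ≡⟨ toℕ-rotate _ i ⟩
  (toℕ i + (suc k ∸ toℕ i + toℕ j)) % suc k ≡⟨ cong (_% suc k) (+-assoc (toℕ i) _ (toℕ j)) ⟨
  (toℕ i + (suc k ∸ toℕ i) + toℕ j) % suc k
    ≡⟨ cong (λ a → (a + toℕ j) % suc k) (m+[n∸m]≡n (<⇒≤ (toℕ<n i))) ⟩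
  (suc k + toℕ j) % suc k                  ≡⟨ cong (_% suc k) (+-comm (suc k) (toℕ j)) ⟩
  (toℕ j + suc k) % suc k                  ≡⟨ [m+n]%n≡m%n (toℕ j) (suc k) ⟩
  toℕ j % suc k                            ≡⟨ m<n⇒m%n≡m (toℕ<n j) ⟩
  toℕ j                                    ∎)
  where open ≡-Reasoning

rotate-1-cyclic : (i j : Fin (suc k)) → ∃ λ t → iter (rotate 1) t i ≡ j
rotate-1-cyclic {k} i j = t , (begin
  iter (rotate 1) t i  ≡⟨ iter-rotate 1 t i ⟩
  rotate (t * 1) i     ≡⟨ cong (λ u → rotate u i) (*-identityʳ t) ⟩
  rotate t i           ≡⟨ rotate-reaches i j ⟩
  j                    ∎)
  where
  open ≡-Reasoning
  t : ℕ
  t = suc k ∸ toℕ i + toℕ j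

rotate-k-cyclic : (i j : Fin (suc k)) → ∃ λ t → iter (rotate k) t i ≡ j
rotate-k-cyclic {k} i j = t , (begin
  iter (rotate k) t i              ≡⟨ iter-rotate k t i ⟩
  rotate (t * k) i                 ≡⟨ cong (rotate (t * k)) (rotate-reaches j i) ⟨
  rotate (t * k) (rotate t j)      ≡⟨ rotate-rotate t (t * k) j ⟩
  rotate (t + t * k) j             ≡⟨ cong (λ u → rotate u j) (*-suc t k) ⟨
  rotate (t * suc k) j             ≡⟨ rotate-full t j ⟩
  j                                ∎)
  where
  open ≡-Reasoning
  t : ℕ
  t = suc k ∸ toℕ j + toℕ i

rotate-1-rotate-k : (i : Fin (suc k)) → rotate 1 (rotate k i) ≡ i
rotate-1-rotate-k {k} i = begin
  rotate 1 (rotate k i)  ≡⟨ rotate-rotate k 1 i ⟩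
  rotate (k + 1) i       ≡⟨ cong (λ u → rotate u i) (trans (+-comm k 1) (sym (*-identityˡ (suc k)))) ⟩
  rotate (1 * suc k) i   ≡⟨ rotate-full 1 i ⟩
  i                      ∎
  where open ≡-Reasoning

iter-map : {A B : Set} (f : A → B) {g : A → A} {h : B → B} → (∀ a → h (f a) ≡ f (g a)) →
  ∀ t a → iter h t (f a) ≡ f (iter g t a)
iter-map f commutes zero    a = refl
iter-map f {g} {h} commutes (suc t) a =
  trans (cong h (iter-map f commutes t a)) (commutes (iter g t a))

rotate-1-follows : {i j : Fin (suc k)} →
  suc (toℕ i) ≡ toℕ j ⊎ (suc (toℕ i) ≡ suc k × toℕ j ≡ 0) → rotate 1 i ≡ j
rotate-1-follows {k} {i} {j} i→j = toℕ-injective (trans (toℕ-rotate 1 i) (cases i→j))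
  where
  cases : suc (toℕ i) ≡ toℕ j ⊎ (suc (toℕ i) ≡ suc k × toℕ j ≡ 0) →
          (toℕ i + 1) % suc k ≡ toℕ j
  cases (inj₁ i+1≡j)      rewrite +-comm (toℕ i) 1 | i+1≡j = m<n⇒m%n≡m (toℕ<n j)
  cases (inj₂ (i+1≡k , j≡0)) rewrite +-comm (toℕ i) 1 | i+1≡k | j≡0 = n%n≡0 (suc k)

closedWalk⇒HasCycle : (G : Graph n) (f : Fin (3 + k) → Fin n) → Injective _≡_ _≡_ f →
  (∀ i → adj G (f i) (f (rotate 1 i)) ≡ true) → HasCycle G (3 + k)
closedWalk⇒HasCycle G f f-inj walk =
  s≤s (s≤s (s≤s z≤n)) , f , f-inj ,
  λ i j i→j → subst (λ x → adj G (f i) (f x) ≡ true) (rotate-1-follows i→j) (walk i)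

adj⇒≢ : (G : Graph n) {x y : Fin n} → adj G x y ≡ true → x ≢ y
adj⇒≢ G {x} xy refl with () ← trans (sym xy) (irrefl G x)

triangle⇒HasCycle : (G : Graph n) {a b c : Fin n} →
  adj G a b ≡ true → adj G b c ≡ true → adj G c a ≡ true → HasCycle G 3
triangle⇒HasCycle {n} G {a} {b} {c} ab bc ca = closedWalk⇒HasCycle G f f-inj walk
  where
  f : Fin 3 → Fin n
  f zero             = a
  f (suc zero)       = b
  f (suc (suc zero)) = c
  a≢b : a ≢ b
  a≢b = adj⇒≢ G ab
  b≢c : b ≢ c
  b≢c = adj⇒≢ G bc
  c≢a : c ≢ a
  c≢a = adj⇒≢ G ca
  f-inj : Injective _≡_ _≡_ f
  f-inj {zero}             {zero}             _ = refl
  f-inj {zero}             {suc zero}         e = ⊥-elim (a≢b e)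
  f-inj {zero}             {suc (suc zero)}   e = ⊥-elim (c≢a (sym e))
  f-inj {suc zero}         {zero}             e = ⊥-elim (a≢b (sym e))
  f-inj {suc zero}         {suc zero}         _ = refl
  f-inj {suc zero}         {suc (suc zero)}   e = ⊥-elim (b≢c e)
  f-inj {suc (suc zero)}   {zero}             e = ⊥-elim (c≢a e)
  f-inj {suc (suc zero)}   {suc zero}         e = ⊥-elim (b≢c (sym e))
  f-inj {suc (suc zero)}   {suc (suc zero)}   _ = refl
  walk : ∀ i → adj G (f i) (f (rotate 1 i)) ≡ true
  walk zero             = ab
  walk (suc zero)       = bc
  walk (suc (suc zero)) = ca

TriangleFree : Graph n → Set
TriangleFree G = ∀ a b c → adj G a b ≡ true → adj G b c ≡ true → adj G c a ≡ true → ⊥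

girth4⇒TriangleFree : (G : Graph n) → HasGirth G 4 → TriangleFree G
girth4⇒TriangleFree G (_ , noShort) _ _ _ ab bc ca =
  noShort 3 ≤-refl (triangle⇒HasCycle G ab bc ca)

xor-triangle : ∀ a b c → xorB a b ≡ true → xorB b c ≡ true → xorB c a ≡ true → ⊥
xor-triangle true  true  _     ()
xor-triangle false false _     ()
xor-triangle true  false true  _ _ ()
xor-triangle true  false false _ ()
xor-triangle false true  true  _ ()
xor-triangle false true  false _ _ ()

TriangleFree⇒no-cycle<4 : (G : Graph n) → TriangleFree G → ∀ ℓ → ℓ < 4 → ¬ HasCycle G ℓ
TriangleFree⇒no-cycle<4 G triangle-free 3 _ (_ , f , _ , walk) =
  triangle-free _ _ _ (walk zero (suc zero) (inj₁ refl)) (walk (suc zero) (suc (suc zero)) (inj₁ refl))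
                (walk (suc (suc zero)) zero (inj₂ (refl , refl)))
TriangleFree⇒no-cycle<4 G _ (suc (suc (suc (suc _)))) (s≤s (s≤s (s≤s (s≤s ())))) _
TriangleFree⇒no-cycle<4 G _ 0 _ (() , _)
TriangleFree⇒no-cycle<4 G _ 1 _ (s≤s () , _)
TriangleFree⇒no-cycle<4 G _ 2 _ (s≤s (s≤s ()) , _)

inPair : Fin n → Fin n → Fin n → Bool
inPair v w x = eqF x v ∨ eqF x w

inPair-first : (v w : Fin n) → inPair v w v ≡ true
inPair-first v w rewrite eqF-refl v = refl

inPair-second : (v w : Fin n) → inPair v w w ≡ true
inPair-second v w rewrite eqF-refl w = ∨-zeroʳ (eqF w v)

inPair-other : {v w x : Fin n} → x ≢ v → x ≢ w → inPair v w x ≡ false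
inPair-other x≢v x≢w rewrite eqF-≢ x≢v | eqF-≢ x≢w = refl

data PairView (v w : Fin n) : Fin n → Set where
  first  : PairView v w v
  second : PairView v w w
  other  : ∀ {x} → x ≢ v → x ≢ w → PairView v w x

pairView : (v w x : Fin n) → PairView v w x
pairView v w x with x ≟ v | x ≟ w
... | yes refl | _        = first
... | no _     | yes refl = second
... | no x≢v   | no x≢w   = other x≢v x≢w

module TriangleFreeMinDegree2 {n : ℕ} (G : Graph n) (triangle-free : TriangleFree G)
                              (degree≥2 : ∀ u → 2 ≤ degree G u) where

  nonNeighbour : Fin n → Fin n → Bool
  nonNeighbour v x = not (adj G v x)

  degree+nonNeighbours : (v : Fin n) → degree G v + count (nonNeighbour v) ≡ n
  degree+nonNeighbours v = trans (sym (count-split (λ _ → true) (adj G v))) count-true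

  neighbour : (v : Fin n) → ∃ λ u → adj G v u ≡ true
  neighbour v = count-witness (adj G v) (≤-trans (s≤s z≤n) (degree≥2 v))

  nonNeighbour-self : (v : Fin n) → nonNeighbour v v ≡ true
  nonNeighbour-self v = cong not (irrefl G v)

  nonNeighbour-at-distance-2 : {v u x : Fin n} → adj G v u ≡ true → adj G u x ≡ true →
    nonNeighbour v x ≡ true
  nonNeighbour-at-distance-2 {v} {u} {x} vu ux =
    cong not (¬-not λ vx → triangle-free _ _ _ vu ux (trans (Graph.sym G x v) vx))

  two≤nonNeighbours : (v : Fin n) → 2 ≤ count (nonNeighbour v)
  two≤nonNeighbours v with neighbour v
  ... | u , vu with count-witness-≢ (adj G u) (degree≥2 u) v
  ...   | x , ux , x≢v =
    length≤count (nonNeighbour v) ((x≢v ∘ sym ∷ []) ∷ [] ∷ [])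
                 (nonNeighbour-self v ∷ nonNeighbour-at-distance-2 vu ux ∷ [])

  2+degree≤order : (v : Fin n) → 2 + degree G v ≤ n
  2+degree≤order v = begin
    2 + degree G v                     ≤⟨ +-monoˡ-≤ (degree G v) (two≤nonNeighbours v) ⟩
    count (nonNeighbour v) + degree G v ≡⟨ +-comm _ (degree G v) ⟩
    degree G v + count (nonNeighbour v) ≡⟨ degree+nonNeighbours v ⟩
    n                                  ∎
    where open ≤-Reasoning

  module Tight (v : Fin n) (tight : count (nonNeighbour v) ≡ 2) where

    private
      second-nonNeighbour : ∃ λ w → nonNeighbour v w ≡ true × w ≢ v
      second-nonNeighbour = count-witness-≢ (nonNeighbour v) (≤-reflexive (sym tight)) v

    w : Fin n
    w = proj₁ second-nonNeighbour

    w≢v : w ≢ v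
    w≢v = proj₂ (proj₂ second-nonNeighbour)

    v≁w : adj G v w ≡ false
    v≁w = not-injective (proj₁ (proj₂ second-nonNeighbour))

    v∼others : {x : Fin n} → x ≢ v → x ≢ w → adj G v x ≡ true
    v∼others {x} x≢v x≢w with adj G v x in v≁x
    ... | true  = refl
    ... | false = ⊥-elim (1+n≰n (subst (3 ≤_) tight (length≤count (nonNeighbour v)
                    ((w≢v ∘ sym ∷ x≢v ∘ sym ∷ []) ∷ (x≢w ∘ sym ∷ []) ∷ [] ∷ [])
                    (nonNeighbour-self v ∷ cong not v≁w ∷ cong not v≁x ∷ []))))

    w∼others : {x : Fin n} → x ≢ v → x ≢ w → adj G x w ≡ true
    w∼others {x} x≢v x≢w with count-witness-≢ (adj G x) (degree≥2 x) v
    ... | y , xy , y≢v with y ≟ w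
    ...   | yes refl = xy
    ...   | no y≢w   = ⊥-elim (triangle-free _ _ _ (v∼others x≢v x≢w) xy
                                             (trans (Graph.sym G y v) (v∼others y≢v y≢w)))

    others-independent : {x y : Fin n} → x ≢ v → x ≢ w → y ≢ v → y ≢ w → adj G x y ≡ false
    others-independent {x} {y} x≢v x≢w y≢v y≢w with adj G x y in xy
    ... | false = refl
    ... | true  = ⊥-elim (triangle-free _ _ _ (v∼others x≢v x≢w) xy
                                        (trans (Graph.sym G y v) (v∼others y≢v y≢w)))

    adj≡xor-inPair : ∀ a b → adj G a b ≡ xorB (inPair v w a) (inPair v w b)
    adj≡xor-inPair a b with pairView v w a | pairView v w b
    ... | first  | first  = trans (irrefl G v) (sym (xor-self (inPair v w v)))
    ... | second | second = trans (irrefl G w) (sym (xor-self (inPair v w w)))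
    ... | first  | second rewrite inPair-first v w | inPair-second v w = v≁w
    ... | second | first  rewrite inPair-first v w | inPair-second v w = trans (Graph.sym G w v) v≁w
    ... | first  | other b≢v b≢w rewrite inPair-first v w | inPair-other b≢v b≢w =
      v∼others b≢v b≢w
    ... | other a≢v a≢w | first rewrite inPair-first v w | inPair-other a≢v a≢w =
      trans (Graph.sym G a v) (v∼others a≢v a≢w)
    ... | second | other b≢v b≢w rewrite inPair-second v w | inPair-other b≢v b≢w =
      trans (Graph.sym G w b) (w∼others b≢v b≢w)
    ... | other a≢v a≢w | second rewrite inPair-second v w | inPair-other a≢v a≢w =
      w∼others a≢v a≢w
    ... | other a≢v a≢w | other b≢v b≢w rewrite inPair-other a≢v a≢w | inPair-other b≢v b≢w =
      others-independent a≢v a≢w b≢v b≢w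

transpose-first : (i j : Fin n) → PC.transpose i j i ≡ j
transpose-first i j rewrite eqF-refl i = refl

transpose-other : {i j k : Fin n} → k ≢ i → k ≢ j → PC.transpose i j k ≡ k
transpose-other k≢i k≢j rewrite eqF-≢ k≢i | eqF-≢ k≢j = refl

pair-to-front : {m : ℕ} {v w : Fin (2 + m)} → v ≢ w →
  ∃ λ (π : Permutation′ (2 + m)) → π ⟨$⟩ʳ v ≡ zero × π ⟨$⟩ʳ w ≡ suc zero
pair-to-front {m} {v} {w} v≢w =
  transpose v zero ∘ₚ transpose w′ (suc zero) , π-v , transpose-first w′ (suc zero)
  where
  w′ : Fin (2 + m)
  w′ = PC.transpose v zero w
  0≢w′ : zero ≢ w′
  0≢w′ 0≡w′ = v≢w (begin
    v                                            ≡⟨ PC.transpose-inverse zero v ⟨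
    PC.transpose zero v (PC.transpose v zero v)  ≡⟨ cong (PC.transpose zero v) (transpose-first v zero) ⟩
    PC.transpose zero v zero                     ≡⟨ cong (PC.transpose zero v) 0≡w′ ⟩
    PC.transpose zero v w′                       ≡⟨ PC.transpose-inverse zero v ⟩
    w                                            ∎)
    where open ≡-Reasoning
  π-v : PC.transpose w′ (suc zero) (PC.transpose v zero v) ≡ zero
  π-v rewrite transpose-first v zero = transpose-other 0≢w′ λ ()

beyond-first-two : {m : ℕ} (y : Fin (2 + m)) → y ≢ zero → y ≢ suc zero →
  (toℕ y <ᵇ 2) ≡ false
beyond-first-two zero          y≢0 _   = ⊥-elim (y≢0 refl)
beyond-first-two (suc zero)    _   y≢1 = ⊥-elim (y≢1 refl)
beyond-first-two (suc (suc _)) _   _   = refl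

xorPair⇒≅K₂ : {m : ℕ} (G : Graph (2 + m)) {v w : Fin (2 + m)} → v ≢ w →
  (∀ a b → adj G a b ≡ xorB (inPair v w a) (inPair v w b)) → Isomorphic G (K 2 m)
xorPair⇒≅K₂ G {v} {w} v≢w adj≡xor with pair-to-front v≢w
... | π , π-v , π-w = π , λ a b → trans (cong₂ xorB (side a) (side b)) (sym (adj≡xor a b))
  where
  π-injective : Injective _≡_ _≡_ (π ⟨$⟩ʳ_)
  π-injective = Injection.injective (↔⇒↣ π)
  side : ∀ x → (toℕ (π ⟨$⟩ʳ x) <ᵇ 2) ≡ inPair v w x
  side x with pairView v w x
  ... | first  rewrite π-v = sym (inPair-first v w)
  ... | second rewrite π-w = sym (inPair-second v w)
  ... | other x≢v x≢w =
    trans (beyond-first-two (π ⟨$⟩ʳ x) (λ πx≡0 → x≢v (π-injective (trans πx≡0 (sym π-v))))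
                                       (λ πx≡1 → x≢w (π-injective (trans πx≡1 (sym π-w)))))
          (sym (inPair-other x≢v x≢w))

order≡2+degree⇒≅K₂ : {m : ℕ} (G : Graph (2 + m)) → TriangleFree G →
  (∀ u → 2 ≤ degree G u) → (v : Fin (2 + m)) → degree G v ≡ m → Isomorphic G (K 2 m)
order≡2+degree⇒≅K₂ {m} G triangle-free degree≥2 v deg-v≡m =
  xorPair⇒≅K₂ G (w≢v ∘ sym) adj≡xor-inPair
  where
  open TriangleFreeMinDegree2 G triangle-free degree≥2
  tight : count (nonNeighbour v) ≡ 2
  tight = +-cancelˡ-≡ m _ 2 (begin
    m + count (nonNeighbour v)          ≡⟨ cong (_+ count (nonNeighbour v)) deg-v≡m ⟨
    degree G v + count (nonNeighbour v) ≡⟨ degree+nonNeighbours v ⟩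
    2 + m                               ≡⟨ +-comm 2 m ⟩
    m + 2                               ∎)
    where open ≡-Reasoning
  open Tight v tight

K₂-TriangleFree : (m : ℕ) → TriangleFree (K 2 m)
K₂-TriangleFree m a b c = xor-triangle (toℕ a <ᵇ 2) (toℕ b <ᵇ 2) (toℕ c <ᵇ 2)

K₂-degree-hub₀ : (m : ℕ) → degree (K 2 m) zero ≡ m
K₂-degree-hub₀ m = count-true {m}

K₂-degree-hub₁ : (m : ℕ) → degree (K 2 m) (suc zero) ≡ m
K₂-degree-hub₁ m = count-true {m}

K₂-degree-leaf : (m : ℕ) (j : Fin m) → degree (K 2 m) (suc (suc j)) ≡ 2
K₂-degree-leaf m j = cong (2 +_) (count-false {m})

K₂-4-cycle : (k : ℕ) → HasCycle (K 2 (2 + k)) 4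
K₂-4-cycle k = closedWalk⇒HasCycle (K 2 (2 + k)) f f-injective walk
  where
  f : Fin 4 → Fin (4 + k)
  f zero                   = zero
  f (suc zero)             = suc (suc zero)
  f (suc (suc zero))       = suc zero
  f (suc (suc (suc zero))) = suc (suc (suc zero))
  f⁻¹ : Fin (4 + k) → Fin 4
  f⁻¹ zero             = zero
  f⁻¹ (suc zero)       = suc (suc zero)
  f⁻¹ (suc (suc zero)) = suc zero
  f⁻¹ _                = suc (suc (suc zero))
  f⁻¹∘f : ∀ i → f⁻¹ (f i) ≡ i
  f⁻¹∘f zero                   = refl
  f⁻¹∘f (suc zero)             = refl
  f⁻¹∘f (suc (suc zero))       = refl
  f⁻¹∘f (suc (suc (suc zero))) = refl
  f-injective : Injective _≡_ _≡_ f
  f-injective {i} {j} fi≡fj = trans (sym (f⁻¹∘f i)) (trans (cong f⁻¹ fi≡fj) (f⁻¹∘f j))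
  walk : ∀ i → adj (K 2 (2 + k)) (f i) (f (rotate 1 i)) ≡ true
  walk zero                   = refl
  walk (suc zero)             = refl
  walk (suc (suc zero))       = refl
  walk (suc (suc (suc zero))) = refl

K₂-girth : (k : ℕ) → HasGirth (K 2 (2 + k)) 4
K₂-girth k = K₂-4-cycle k , TriangleFree⇒no-cycle<4 (K 2 (2 + k)) (K₂-TriangleFree (2 + k))

K₂-IsRMGGraph : (k : ℕ) → IsRMGGraph 2 (2 + k) 4 (K 2 (2 + k))
K₂-IsRMGGraph k =
  K₂-girth k , degrees , (suc (suc zero) , K₂-degree-leaf m zero) , (zero , K₂-degree-hub₀ m)
  where
  m : ℕ
  m = 2 + k
  degrees : ∀ u → degree (K 2 m) u ≡ 2 ⊎ degree (K 2 m) u ≡ m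
  degrees zero          = inj₂ (K₂-degree-hub₀ m)
  degrees (suc zero)    = inj₂ (K₂-degree-hub₁ m)
  degrees (suc (suc j)) = inj₁ (K₂-degree-leaf m j)

or-loop-false : (Q h : ℕ → Bool) → h 0 ≡ false → (∀ t → h (suc t) ≡ (Q t ∨ h t)) →
  (∀ t → Q t ≡ false) → ∀ N → h N ≡ false
or-loop-false Q h h0 hsuc Q-false zero    = h0
or-loop-false Q h h0 hsuc Q-false (suc N)
  rewrite hsuc N | Q-false N = or-loop-false Q h h0 hsuc Q-false N

or-loop-true : (Q h : ℕ → Bool) → ∀ {t} → (∀ t → h (suc t) ≡ (Q t ∨ h t)) →
  Q t ≡ true → ∀ N → t < N → h N ≡ true
or-loop-true Q h {t} hsuc Qt (suc N) t<1+N with m<1+n⇒m<n∨m≡n t<1+N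
... | inj₂ refl rewrite hsuc t | Qt = refl
... | inj₁ t<N  rewrite hsuc N | or-loop-true Q h hsuc Qt N t<N = ∨-zeroʳ (Q N)

-- The scan inside isFaceRep is a where-bound function that cannot be named;
-- abstracting n * n together with the loop lemma lets unification supply it as h.
isFaceRep-true : {G : Graph n} (R : Rotation G) (d : Dart n) →
  (∀ t → rank d ≤ rank (iter (facePerm R) (suc t) d)) → isFaceRep R d ≡ true
isFaceRep-true {n} R d minimal
  with n * n | or-loop-false (λ t → rank (iter (facePerm R) (suc t) d) <ᵇ rank d) _
... | N | loop =
  cong not (loop refl (λ _ → refl) (λ t → dec-false (_ <? _) (≤⇒≯ (minimal t))) N)

isFaceRep-false : {G : Graph n} (R : Rotation G) (d : Dart n) (t : ℕ) → t < n * n →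
  rank (iter (facePerm R) (suc t) d) < rank d → isFaceRep R d ≡ false
isFaceRep-false {n} R d t t<n*n smaller
  with n * n | or-loop-true (λ t → rank (iter (facePerm R) (suc t) d) <ᵇ rank d) _ | t<n*n
... | N | loop | t<N = cong not (loop (λ _ → refl) (dec-true (_ <? _) smaller) N t<N)

rank-from-zero<rank-from-suc : (x : Fin (suc n)) (u : Fin n) (y : Fin (suc n)) →
  rank (zero , x) < rank (suc u , y)
rank-from-zero<rank-from-suc {n} x u y = begin-strict
  toℕ x                                   <⟨ toℕ<n x ⟩
  suc n                                   ≤⟨ m≤m+n (suc n) (toℕ u * suc n) ⟩
  suc n + toℕ u * suc n                   ≤⟨ m≤m+n _ (toℕ y) ⟩
  suc n + toℕ u * suc n + toℕ y           ∎
  where open ≤-Reasoning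

anyF-true : (p : Fin n → Bool) {x : Fin n} → p x ≡ true → anyF p ≡ true
anyF-true p {zero}  px rewrite px = refl
anyF-true p {suc x} px rewrite anyF-true (λ i → p (suc i)) px = ∨-zeroʳ (p zero)

anyF-false : anyF {n} (λ _ → false) ≡ false
anyF-false {zero}  = refl
anyF-false {suc n} = anyF-false {n}

sumF-zero : {f : Fin n → ℕ} → (∀ x → f x ≡ 0) → sumF f ≡ 0
sumF-zero {zero}  f≗0 = refl
sumF-zero {suc n} f≗0 rewrite f≗0 zero = sumF-zero (λ x → f≗0 (suc x))

reach-step : (G : Graph n) {k : ℕ} {u w v : Fin n} →
  reach G k u w ≡ true → adj G w v ≡ true → reach G (suc k) u v ≡ true
reach-step G {k} {u} {w} {v} uw wv
  rewrite anyF-true (λ x → reach G k u x ∧ adj G x v) (cong₂ _∧_ uw wv) =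
  ∨-zeroʳ (reach G k u v)

reach-mono : (G : Graph n) {k k′ : ℕ} {u v : Fin n} → k ≤ k′ →
  reach G k u v ≡ true → reach G k′ u v ≡ true
reach-mono G k≤k′ = go (≤⇒≤′ k≤k′)
  where
  go : ∀ {k k′ u v} → k ≤′ k′ → reach G k u v ≡ true → reach G k′ u v ≡ true
  go ≤′-refl        uv = uv
  go (≤′-step k≤k′) uv rewrite go k≤k′ uv = refl

connected⇒components≡1 : (G : Graph (suc n)) → (∀ v → reach G (suc n) zero v ≡ true) →
  components G ≡ 1
connected⇒components≡1 {n} G reach₀ rewrite anyF-false {n} =
  cong suc (trans (count-ext (λ i → cong not (reached-earlier i))) (count-false {n}))
  where
  earlier-reaches : Fin n → Fin (suc n) → Bool
  earlier-reaches i w = (toℕ w <ᵇ suc (toℕ i)) ∧ reach G (suc n) w (suc i)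
  reached-earlier : (i : Fin n) → anyF (earlier-reaches i) ≡ true
  reached-earlier i = anyF-true (earlier-reaches i) {zero} (reach₀ (suc i))

module K₂-Embedding (k : ℕ) where

  private
    m : ℕ
    m = suc k
    G : Graph (2 + m)
    G = K 2 m
    V : Set
    V = Fin (2 + m)

  leaf : Fin m → V
  leaf j = suc (suc j)

  data Arc : V → V → Set where
    hub₀→leaf : ∀ j → Arc zero (leaf j)
    hub₁→leaf : ∀ j → Arc (suc zero) (leaf j)
    leaf→hub₀ : ∀ j → Arc (leaf j) zero
    leaf→hub₁ : ∀ j → Arc (leaf j) (suc zero)

  arc : ∀ u v → adj G u v ≡ true → Arc u v
  arc zero          (suc (suc j)) _ = hub₀→leaf j
  arc (suc zero)    (suc (suc j)) _ = hub₁→leaf j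
  arc (suc (suc j)) zero          _ = leaf→hub₀ j
  arc (suc (suc j)) (suc zero)    _ = leaf→hub₁ j
  arc zero          zero          ()
  arc zero          (suc zero)    ()
  arc (suc zero)    zero          ()
  arc (suc zero)    (suc zero)    ()
  arc (suc (suc _)) (suc (suc _)) ()

  -- Leaves advance around hub 0 and go back around hub 1, which makes every face
  -- a 4-cycle; the last clause, on non-neighbours, is arbitrary.
  nextNeighbour : V → V → V
  nextNeighbour zero          (suc (suc j)) = leaf (rotate 1 j)
  nextNeighbour (suc zero)    (suc (suc j)) = leaf (rotate k j)
  nextNeighbour (suc (suc _)) zero          = suc zero
  nextNeighbour (suc (suc _)) (suc zero)    = zero
  nextNeighbour _             v             = v

  nextNeighbour-closed : ∀ u v → adj G u v ≡ true → adj G u (nextNeighbour u v) ≡ true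
  nextNeighbour-closed u v uv with arc u v uv
  ... | hub₀→leaf _ = refl
  ... | hub₁→leaf _ = refl
  ... | leaf→hub₀ _ = refl
  ... | leaf→hub₁ _ = refl

  nextNeighbour-cyclic : ∀ u v w → adj G u v ≡ true → adj G u w ≡ true →
    ∃ λ t → iter (nextNeighbour u) t v ≡ w
  nextNeighbour-cyclic u v w uv uw with arc u v uv | arc u w uw
  ... | hub₀→leaf i | hub₀→leaf j with rotate-1-cyclic i j
  ...   | t , i↦j = t , trans (iter-map leaf (λ _ → refl) t i) (cong leaf i↦j)
  nextNeighbour-cyclic u v w uv uw | hub₁→leaf i | hub₁→leaf j with rotate-k-cyclic i j
  ...   | t , i↦j = t , trans (iter-map leaf (λ _ → refl) t i) (cong leaf i↦j)
  nextNeighbour-cyclic u v w uv uw | leaf→hub₀ _ | leaf→hub₀ _ = 0 , refl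
  nextNeighbour-cyclic u v w uv uw | leaf→hub₀ _ | leaf→hub₁ _ = 1 , refl
  nextNeighbour-cyclic u v w uv uw | leaf→hub₁ _ | leaf→hub₀ _ = 1 , refl
  nextNeighbour-cyclic u v w uv uw | leaf→hub₁ _ | leaf→hub₁ _ = 0 , refl

  R : Rotation G
  R = record { ρ = nextNeighbour ; closed = nextNeighbour-closed ; cyclic = nextNeighbour-cyclic }

  face : Dart (2 + m) → Dart (2 + m)
  face = facePerm R

  data InFaceOf (j : Fin m) : Dart (2 + m) → Set where
    hub₀-leaf : InFaceOf j (zero , leaf j)
    leaf-hub₁ : InFaceOf j (leaf j , suc zero)
    hub₁-leaf : InFaceOf j (suc zero , leaf (rotate k j))
    leaf-hub₀ : InFaceOf j (leaf (rotate k j) , zero)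

  face-closed : ∀ {j d} → InFaceOf j d → InFaceOf j (face d)
  face-closed hub₀-leaf = leaf-hub₁
  face-closed leaf-hub₁ = hub₁-leaf
  face-closed hub₁-leaf = leaf-hub₀
  face-closed {j} leaf-hub₀ =
    subst (λ i → InFaceOf j (zero , leaf i)) (sym (rotate-1-rotate-k j)) hub₀-leaf

  iterates-InFaceOf : ∀ j t → InFaceOf j (iter face t (zero , leaf j))
  iterates-InFaceOf j zero    = hub₀-leaf
  iterates-InFaceOf j (suc t) = face-closed (iterates-InFaceOf j t)

  InFaceOf-rank : ∀ {j d} → InFaceOf j d → rank (zero , leaf j) ≤ rank d
  InFaceOf-rank         hub₀-leaf = ≤-refl
  InFaceOf-rank {j} leaf-hub₁ = <⇒≤ (rank-from-zero<rank-from-suc (leaf j) (suc j) (suc zero))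
  InFaceOf-rank {j} hub₁-leaf = <⇒≤ (rank-from-zero<rank-from-suc (leaf j) zero (leaf (rotate k j)))
  InFaceOf-rank {j} leaf-hub₀ = <⇒≤ (rank-from-zero<rank-from-suc (leaf j) (suc (rotate k j)) zero)

  hub₀-represents : ∀ j → isFaceRep R (zero , leaf j) ≡ true
  hub₀-represents j =
    isFaceRep-true R (zero , leaf j) (λ t → InFaceOf-rank (iterates-InFaceOf j (suc t)))

  2<order² : 2 < (2 + m) * (2 + m)
  2<order² = ≤-trans (s≤s (s≤s (s≤s z≤n))) (m≤m*n (2 + m) (2 + m))

  hub₁-not-represents : ∀ j → isFaceRep R (suc zero , leaf j) ≡ false
  hub₁-not-represents j = isFaceRep-false R (suc zero , leaf j) 1 (<-trans (s≤s (s≤s z≤n)) 2<order²)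
    (rank-from-zero<rank-from-suc (leaf (rotate 1 j)) zero (leaf j))

  leaf-hub₀-not-represents : ∀ j → isFaceRep R (leaf j , zero) ≡ false
  leaf-hub₀-not-represents j = isFaceRep-false R (leaf j , zero) 0 (<-trans (s≤s z≤n) 2<order²)
    (rank-from-zero<rank-from-suc (leaf (rotate 1 j)) (suc j) zero)

  leaf-hub₁-not-represents : ∀ j → isFaceRep R (leaf j , suc zero) ≡ false
  leaf-hub₁-not-represents j = isFaceRep-false R (leaf j , suc zero) 2 2<order²
    (rank-from-zero<rank-from-suc (leaf (rotate 1 (rotate k j))) (suc j) (suc zero))

  facesAt : V → ℕ
  facesAt u = count (λ v → adj G u v ∧ isFaceRep R (u , v))

  no-isolated : isolated G ≡ 0
  no-isolated = trans (count-ext positive) (count-false {2 + m})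
    where
    positive : ∀ v → (degree G v ≡ᵇ 0) ≡ false
    positive zero          = cong (_≡ᵇ 0) (K₂-degree-hub₀ m)
    positive (suc zero)    = cong (_≡ᵇ 0) (K₂-degree-hub₁ m)
    positive (suc (suc j)) = cong (_≡ᵇ 0) (K₂-degree-leaf m j)

  faces-K₂ : faces R ≡ m
  faces-K₂ = begin
    facesAt zero + (facesAt (suc zero) + sumF (facesAt ∘ leaf)) + isolated G
      ≡⟨ cong₂ _+_ (cong₂ _+_ at-hub₀ (cong₂ _+_ at-hub₁ at-leaves)) no-isolated ⟩
    m + 0 + 0
      ≡⟨ cong (_+ 0) (+-identityʳ m) ⟩
    m + 0
      ≡⟨ +-identityʳ m ⟩
    m ∎
    where
    open ≡-Reasoning
    at-hub₀ : facesAt zero ≡ m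
    at-hub₀ = trans (count-ext hub₀-represents) (count-true {m})
    at-hub₁ : facesAt (suc zero) ≡ 0
    at-hub₁ = trans (count-ext hub₁-not-represents) (count-false {m})
    at-leaves : sumF (facesAt ∘ leaf) ≡ 0
    at-leaves = sumF-zero at-leaf
      where
      at-leaf : ∀ j → facesAt (leaf j) ≡ 0
      at-leaf j rewrite leaf-hub₀-not-represents j | leaf-hub₁-not-represents j = count-false {m}

  edgesAt : V → ℕ
  edgesAt u = count (λ v → adj G u v ∧ (toℕ u <ᵇ toℕ v))

  edges-K₂ : edges G ≡ m + m
  edges-K₂ = cong₂ _+_ (count-true {m}) (trans (cong₂ _+_ (count-true {m}) at-leaves) (+-identityʳ m))
    where
    at-leaves : sumF (edgesAt ∘ leaf) ≡ 0
    at-leaves = sumF-zero {f = edgesAt ∘ leaf} λ _ → count-false {m}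

  components-K₂ : components G ≡ 1
  components-K₂ = connected⇒components≡1 G reach₀
    where
    leaf-in-1 : ∀ j → reach G 1 zero (leaf j) ≡ true
    leaf-in-1 j = reach-step G {0} {zero} {zero} {leaf j} (eqF-refl {2 + m} zero) refl
    hub₁-in-2 : reach G 2 zero (suc zero) ≡ true
    hub₁-in-2 = reach-step G {1} {zero} {leaf zero} {suc zero} (leaf-in-1 zero) refl
    reach₀ : ∀ v → reach G (2 + m) zero v ≡ true
    reach₀ zero          = reach-mono G {0} {2 + m} {zero} {zero} z≤n (eqF-refl {2 + m} zero)
    reach₀ (suc zero)    = reach-mono G {2} {2 + m} {zero} {suc zero} (s≤s (s≤s z≤n)) hub₁-in-2
    reach₀ (suc (suc j)) = reach-mono G {1} {2 + m} {zero} {leaf j} (s≤s z≤n) (leaf-in-1 j)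

  planar : Planar G
  planar = R , (begin
    2 + m + faces R             ≡⟨ cong (2 + m +_) faces-K₂ ⟩
    2 + (m + m)                 ≡⟨ +-comm 2 (m + m) ⟩
    m + m + 2 * 1               ≡⟨ cong₂ (λ e c → e + 2 * c) edges-K₂ components-K₂ ⟨
    edges G + 2 * components G  ∎)
    where open ≡-Reasoning

module _ {n m : ℕ} (2≤m : 2 ≤ m) (G : Graph n) (G-rmg : IsRMGGraph 2 m 4 G) where

  private
    triangle-free : TriangleFree G
    triangle-free = girth4⇒TriangleFree G (proj₁ G-rmg)

    degree≥2 : ∀ u → 2 ≤ degree G u
    degree≥2 u with proj₁ (proj₂ G-rmg) u
    ... | inj₁ deg≡2 = ≤-reflexive (sym deg≡2)
    ... | inj₂ deg≡m = subst (2 ≤_) (sym deg≡m) 2≤m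

    hub : ∃ λ v → degree G v ≡ m
    hub = proj₂ (proj₂ (proj₂ G-rmg))

  RMG-2+m≤order : 2 + m ≤ n
  RMG-2+m≤order = subst (λ d → 2 + d ≤ n) (proj₂ hub)
    (TriangleFreeMinDegree2.2+degree≤order G triangle-free degree≥2 (proj₁ hub))

  RMG-order≡2+m⇒≅K₂ : n ≡ 2 + m → Isomorphic G (K 2 m)
  RMG-order≡2+m⇒≅K₂ refl =
    order≡2+degree⇒≅K₂ G triangle-free degree≥2 (proj₁ hub) (proj₂ hub)

K₂-IsPlanarCage : (k : ℕ) → IsPlanarCage 2 (2 + k) 4 (K 2 (2 + k))
K₂-IsPlanarCage k = K₂-Embedding.planar (suc k) , K₂-IsRMGGraph k ,
                    λ _ H _ H-rmg → RMG-2+m≤order (s≤s (s≤s z≤n)) H H-rmg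

IsPlanarCage⇒≅K₂ : (k n : ℕ) (G : Graph n) → IsPlanarCage 2 (2 + k) 4 G →
  Isomorphic G (K 2 (2 + k))
IsPlanarCage⇒≅K₂ k n G (_ , G-rmg , minimal) = RMG-order≡2+m⇒≅K₂ 2≤m G G-rmg
  (≤-antisym (minimal _ (K 2 (2 + k)) (proj₁ (K₂-IsPlanarCage k)) (K₂-IsRMGGraph k))
             (RMG-2+m≤order 2≤m G G-rmg))
  where
  2≤m : 2 ≤ 2 + k
  2≤m = s≤s (s≤s z≤n)

mainTheorem20 : (m : ℕ) → 3 ≤ m →
    IsPlanarCage 2 m 4 (K 2 m) ×
    (∀ n (G : Graph n) → IsPlanarCage 2 m 4 G → Isomorphic G (K 2 m))
mainTheorem20 1 (s≤s ())
-- The argument works for every m ≥ 2; the hypothesis is only needed to exclude m = 1.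
mainTheorem20 (suc (suc k)) _ = K₂-IsPlanarCage k , IsPlanarCage⇒≅K₂ k
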